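{- Let $m$ be a positive integer and let $D,D'$ be ASDs with $|\mathcal{S}_D|=|\mathcal{S}_{D'}|=m$ and $D\le D'$. Then $i(D)\ge i(D')$.
   Context: An ASD is a pair $D=(\mathcal{S}_D,\mathcal{P}_D)$ with $\mathcal{S}_D$ a finite set and $\mathcal{P}_D$ a finite family of set partitions of $\mathcal{S}_D$. For partitions, $\pi\preceq\pi'$ means every block of $\pi$ lies in a block of $\pi'$; $\wedge$ is the meet; $\mathrm{id}_{\mathcal{S}}$ is the partition into singletons. For $\phi:\mathcal{S}\to\mathcal{S}'$ and a partition $\pi$ of $\mathcal{S}'$, $\pi\circ\phi$ is the partition of $\mathcal{S}$ where $x,y$ share a block iff $\phi(x),\phi(y)$ share a block of $\pi$. $D\le D'$ means there exist $\phi:\mathcal{S}_D\to\mathcal{S}_{D'}$, $\alpha:\mathcal{P}_D\to\mathcal{P}_{D'}$ with $\alpha(\pi)\circ\phi\preceq\pi$ for all $\pi\in\mathcal{P}_D$. $D$ is perfect if $\mathrm{id}_{\mathcal{S}_D}\in\mathcal{P}_D$. For $k\ge1$, $D^{(k)}$ has state space $\mathcal{S}_D$ and partition set $\{\pi_1\wedge\cdots\wedge\pi_k:\pi_i\in\mathcal{P}_D\}$. The perfectness index $i(D)$ is the least integer $k\ge1$ such that $D^{(k)}$ is perfect, and $i(D)=\infty$ if no such $k$ exists. -}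

module Defs where

open import Data.Nat using (ℕ; zero; suc; _≤_; _<_)
open import Data.Fin using (Fin)
open import Data.List using (List; []; _∷_; [_]; length; lookup; map; concatMap)
open import Data.Product using (Σ; ∃; _×_; _,_)
open import Data.Unit.Polymorphic using (⊤)
open import Relation.Nullary using (¬_)
open import Relation.Binary.Structures using (IsEquivalence)
open import Relation.Binary.PropositionalEquality using (_≡_; isEquivalence)
open import Level using (0ℓ)

-- A set partition of the finite state space Fin n, given by its
-- "same block" relation, which is an equivalence relation on Fin n
-- (set partitions of a set correspond exactly to equivalence relations).
record Partition (n : ℕ) : Set₁ where
  field
    _∼_   : Fin n → Fin n → Set
    isEqv : IsEquivalence _∼_
open Partition public

_⪯_ : ∀ {n} → Partition n → Partition n → Set
π ⪯ π' = ∀ x y → _∼_ π x y → _∼_ π' x y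

_≐_ : ∀ {n} → Partition n → Partition n → Set
π ≐ π' = (π ⪯ π') × (π' ⪯ π)

idP : ∀ n → Partition n
idP n = record { _∼_ = _≡_ ; isEqv = isEquivalence }

-- the one-block partition (the empty meet; only used as the base of a recursion)
topP : ∀ n → Partition n
topP n = record { _∼_ = λ _ _ → ⊤ ; isEqv = record { refl = _ ; sym = λ _ → _ ; trans = λ _ _ → _ } }

_∧P_ : ∀ {n} → Partition n → Partition n → Partition n
π ∧P σ = record
  { _∼_ = λ x y → _∼_ π x y × _∼_ σ x y
  ; isEqv = record
    { refl  = IsEquivalence.refl (isEqv π) , IsEquivalence.refl (isEqv σ)
    ; sym   = λ { (p , q) → IsEquivalence.sym (isEqv π) p , IsEquivalence.sym (isEqv σ) q }
    ; trans = λ { (p , q) (p' , q') → IsEquivalence.trans (isEqv π) p p' , IsEquivalence.trans (isEqv σ) q q' }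
    }
  }

_∘P_ : ∀ {n n'} → Partition n' → (Fin n → Fin n') → Partition n
π ∘P φ = record
  { _∼_ = λ x y → _∼_ π (φ x) (φ y)
  ; isEqv = record
    { refl  = IsEquivalence.refl (isEqv π)
    ; sym   = IsEquivalence.sym (isEqv π)
    ; trans = IsEquivalence.trans (isEqv π)
    }
  }

-- An ASD with state space Fin n: a finite family (list) of partitions of Fin n.
record ASD (n : ℕ) : Set₁ where
  constructor mkASD
  field
    parts : List (Partition n)
open ASD public

_≤ASD_ : ∀ {n n'} → ASD n → ASD n' → Set
_≤ASD_ {n} {n'} D D' =
  Σ (Fin n → Fin n') λ φ →
  Σ (Fin (length (parts D)) → Fin (length (parts D'))) λ α →
  ∀ i → (lookup (parts D') (α i) ∘P φ) ⪯ lookup (parts D) i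

Perfect : ∀ {n} → ASD n → Set
Perfect {n} D = ∃ λ i → lookup (parts D) i ≐ idP n

meets : ∀ {n} → ℕ → List (Partition n) → List (Partition n)
meets {n} zero    P = [ topP n ]
meets     (suc k) P = concatMap (λ π → map (π ∧P_) (meets k P)) P

-- D^(k): partitions π₁ ∧ ⋯ ∧ π_k, πᵢ ∈ P_D   (used only for k ≥ 1)
_^⟨_⟩ : ∀ {n} → ASD n → ℕ → ASD n
D ^⟨ k ⟩ = mkASD (meets k (parts D))

data ℕ∞ : Set where
  fin : ℕ → ℕ∞
  ∞   : ℕ∞

data _≤∞_ : ℕ∞ → ℕ∞ → Set where
  fin≤fin : ∀ {a b} → a ≤ b → fin a ≤∞ fin b
  _≤∞∞    : ∀ a → a ≤∞ ∞

IsPerfIndex : ∀ {n} → ASD n → ℕ∞ → Set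
IsPerfIndex D (fin k) = (1 ≤ k) × Perfect (D ^⟨ k ⟩) × (∀ j → 1 ≤ j → j < k → ¬ Perfect (D ^⟨ j ⟩))
IsPerfIndex D ∞       = ∀ k → 1 ≤ k → ¬ Perfect (D ^⟨ k ⟩)

module Submission where

-- A witness (φ, α) of D ≤ D' says that every partition π of D
-- is refined by the pullback π' ∘ φ of some partition π' of D'.  Pullback
-- commutes with meets, so the same holds for k-fold meets: every partition of
-- D^(k) is refined by the pullback of some partition σ' of D'^(k).  If D^(k)
-- is perfect, take π = id; then σ' ∘ φ ⪯ id forces φ to be injective, hence
-- (both state spaces being Fin m) bijective, and transporting along φ shows
-- σ' = id, i.e. D'^(k) is perfect.  Finally, "D^(k) perfect ⇒ D'^(k) perfect
-- for every k" means D' becomes perfect no later than D, i.e. i(D') ≤ i(D).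

open import Defs
open import Data.Nat using (ℕ; zero; suc; _≤_)
open import Data.Nat.Properties using (1+n≰n; _<?_; ≮⇒≥)
open import Data.Fin using (Fin; punchOut)
open import Data.Fin.Properties using (any?; _≟_; injective⇒≤; punchOut-injective)
open import Data.List using (List; lookup; map)
open import Data.List.Membership.Propositional using (_∈_; find)
open import Data.List.Membership.Propositional.Properties
  using (∈-concatMap⁺; ∈-concatMap⁻; ∈-map⁺; ∈-map⁻; ∈-lookup)
open import Data.List.Relation.Unary.Any as Any using (here; there)
open import Data.List.Relation.Unary.Any.Properties using (lookup-index)
open import Data.Product using (∃; _×_; _,_)
open import Data.Empty using (⊥-elim)
open import Function.Definitions using (Injective)
open import Relation.Nullary using (¬_; yes; no)
open import Relation.Binary.PropositionalEquality using (_≡_; refl; sym; subst; cong)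
open import Relation.Binary.Structures using (IsEquivalence)

-- P' covers P along φ: every partition in P is refined by the pullback along
-- φ of some partition in P'.  This is the membership form of D ≤ D'.
Covers : ∀ {n n'} → (Fin n → Fin n') → List (Partition n) → List (Partition n') → Set₁
Covers φ P P' = ∀ {π} → π ∈ P → ∃ λ π' → π' ∈ P' × ((π' ∘P φ) ⪯ π)

≤ASD⇒Covers : ∀ {n n'} {D : ASD n} {D' : ASD n'} (le : D ≤ASD D') →
  let (φ , _) = le in Covers φ (parts D) (parts D')
≤ASD⇒Covers {D' = D'} (φ , α , refines) π∈ =
  lookup (parts D') j , ∈-lookup j ,
  subst (λ π → (lookup (parts D') j ∘P φ) ⪯ π) (sym (lookup-index π∈)) (refines i)
  where
  i = Any.index π∈
  j = α i

∧P-pullback-⪯ : ∀ {n n'} {φ : Fin n → Fin n'} {π τ : Partition n} {π' τ' : Partition n'} →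
  (π' ∘P φ) ⪯ π → (τ' ∘P φ) ⪯ τ → ((π' ∧P τ') ∘P φ) ⪯ (π ∧P τ)
∧P-pullback-⪯ π'≤π τ'≤τ x y (p , q) = π'≤π x y p , τ'≤τ x y q

∈-meets⁻ : ∀ {n} k {P : List (Partition n)} {σ} → σ ∈ meets (suc k) P →
  ∃ λ π → π ∈ P × ∃ λ τ → τ ∈ meets k P × σ ≡ π ∧P τ
∈-meets⁻ k {P} σ∈ with find (∈-concatMap⁻ (λ π → map (π ∧P_) (meets k P)) {xs = P} σ∈)
... | π , π∈ , σ∈πτ with ∈-map⁻ (π ∧P_) σ∈πτ
...   | τ , τ∈ , σ≡ = π , π∈ , τ , τ∈ , σ≡

∈-meets⁺ : ∀ {n} k {P : List (Partition n)} {π τ} → π ∈ P → τ ∈ meets k P →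
  (π ∧P τ) ∈ meets (suc k) P
∈-meets⁺ k {P} π∈ τ∈ =
  ∈-concatMap⁺ (λ ρ → map (ρ ∧P_) (meets k P)) (Any.map (λ { refl → ∈-map⁺ (_ ∧P_) τ∈ }) π∈)

meets-Covers : ∀ {n n'} {φ : Fin n → Fin n'} {P P'} → Covers φ P P' → ∀ k →
  Covers φ (meets k P) (meets k P')
meets-Covers {n' = n'} cov zero (here refl) = topP n' , here refl , λ _ _ _ → _
meets-Covers {φ = φ} {P} {P'} cov (suc k) σ∈ with ∈-meets⁻ k {P} σ∈
... | π , π∈ , τ , τ∈ , refl with cov π∈ | meets-Covers {φ = φ} {P} {P'} cov k τ∈
...   | π' , π'∈ , π'≤π | τ' , τ'∈ , τ'≤τ =
  π' ∧P τ' , ∈-meets⁺ k {P'} π'∈ τ'∈ , ∧P-pullback-⪯ {φ = φ} {π} {τ} {π'} {τ'} π'≤π τ'≤τ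

pullback-discrete⇒injective : ∀ {n n'} {φ : Fin n → Fin n'} (σ : Partition n') →
  (σ ∘P φ) ⪯ idP n → Injective _≡_ _≡_ φ
pullback-discrete⇒injective {φ = φ} σ σφ≤id {x} {y} φx≡φy =
  σφ≤id x y (subst (_∼_ σ (φ x)) φx≡φy (IsEquivalence.refl (isEqv σ)))

-- Finite pigeonhole: an injective endomap of Fin m is surjective.  Otherwise
-- it would miss some y and, composed with punchOut y, inject Fin m into Fin (m-1).
injective⇒surjective : ∀ {m} {f : Fin m → Fin m} → Injective _≡_ _≡_ f →
  ∀ y → ∃ λ x → f x ≡ y
injective⇒surjective {suc m} {f} f-inj y with any? (λ x → f x ≟ y)
... | yes hit = hit
... | no miss = ⊥-elim (1+n≰n (injective⇒≤ g-inj))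
  where
  y≢f : ∀ x → ¬ (y ≡ f x)
  y≢f x y≡fx = miss (x , sym y≡fx)
  g : Fin (suc m) → Fin m
  g x = punchOut (y≢f x)
  g-inj : Injective _≡_ _≡_ g
  g-inj gx≡gy = f-inj (punchOut-injective (y≢f _) (y≢f _) gx≡gy)

pullback-discrete-along-surjection : ∀ {n n'} {φ : Fin n → Fin n'} (σ : Partition n') →
  (∀ y → ∃ λ x → φ x ≡ y) → (σ ∘P φ) ⪯ idP n → σ ≐ idP n'
pullback-discrete-along-surjection {φ = φ} σ φ-surj σφ≤id = σ≤id , id≤σ
  where
  σ≤id : σ ⪯ idP _
  σ≤id a b a∼b with φ-surj a | φ-surj b
  ... | x , refl | y , refl = cong φ (σφ≤id x y a∼b)
  id≤σ : idP _ ⪯ σ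
  id≤σ a .a refl = IsEquivalence.refl (isEqv σ)

Covers-preserves-discrete : ∀ {m} {φ : Fin m → Fin m} {P P'} → Covers φ P P' →
  ∀ {π} → π ∈ P → π ≐ idP m → ∃ λ σ → σ ∈ P' × σ ≐ idP m
Covers-preserves-discrete cov π∈ (π≤id , _) with cov π∈
... | σ , σ∈ , σφ≤π =
  σ , σ∈ , pullback-discrete-along-surjection σ (injective⇒surjective φ-inj) σφ≤id
  where
  σφ≤id = λ x y r → π≤id x y (σφ≤π x y r)
  φ-inj = pullback-discrete⇒injective σ σφ≤id

perfect-transfer : ∀ {m} {D D' : ASD m} → D ≤ASD D' → ∀ k →
  Perfect (D ^⟨ k ⟩) → Perfect (D' ^⟨ k ⟩)
perfect-transfer {m} {D} le k (i , π≐id)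
  with Covers-preserves-discrete (meets-Covers (≤ASD⇒Covers le) k)
         (∈-lookup {xs = meets k (parts D)} i) π≐id
... | σ , σ∈ , σ≐id = Any.index σ∈ , subst (_≐ idP m) (lookup-index σ∈) σ≐id

perfIndex-antitone : ∀ {n n'} {D : ASD n} {D' : ASD n'} →
  (∀ k → Perfect (D ^⟨ k ⟩) → Perfect (D' ^⟨ k ⟩)) →
  ∀ a b → IsPerfIndex D a → IsPerfIndex D' b → b ≤∞ a
perfIndex-antitone transfer ∞       b       _              _ = b ≤∞∞
perfIndex-antitone transfer (fin k) ∞       (1≤k , Dk , _) never = ⊥-elim (never k 1≤k (transfer k Dk))
perfIndex-antitone transfer (fin k) (fin l) (1≤k , Dk , _) (_ , _ , l-least) with k <? l
... | yes k<l = ⊥-elim (l-least k 1≤k k<l (transfer k Dk))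
... | no  k≮l = fin≤fin (≮⇒≥ k≮l)

proposition4 : (m : ℕ) → 1 ≤ m → (D D' : ASD m) → D ≤ASD D' →
    (a b : ℕ∞) → IsPerfIndex D a → IsPerfIndex D' b → b ≤∞ a
proposition4 m _ D D' le = perfIndex-antitone (perfect-transfer le)
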